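{- Let $q$ be a power of an odd prime with $q\equiv 1\pmod 4$, let $V$ be a $2m$-dimensional vector space over $\mathbb{F}_q$ with a non-degenerate alternating bilinear form $f$, and let $\omega\in\mathbb{F}_q$ satisfy $\omega^2=-1$. Let $\sigma\in\mathrm{Sp}(V)$ satisfy $\sigma^2=-I$. Let $X,Y,Z$ be three different $\sigma$-invariant totally isotropic $m$-dimensional subspaces of $V$ with $X\cap Y=Y\cap Z=Z\cap X=0$. Then $m$ is even, and the six subspaces $X_\omega,X_{\omega^{ -1}},Y_\omega,Y_{\omega^{ -1}},Z_\omega,Z_{\omega^{ -1}}$ all have dimension $m/2$.
   Context: $\mathrm{Sp}(V)$ is the isometry group of $f$. For a $\sigma$-invariant subspace $U$, $U_\omega=\{u\in U:\sigma u=\omega u\}$ and $U_{\omega^{ -1}}=\{u\in U:\sigma u=\omega^{ -1}u\}$. A subspace is totally isotropic if $f$ vanishes identically on it. -}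

module Defs where

open import Level using (Level; _⊔_; suc)
open import Algebra.Bundles using (CommutativeRing)
open import Data.Nat as ℕ using (ℕ; _∸_)
open import Data.Nat.Primality using (Prime)
open import Data.Nat.DivMod using (_%_)
open import Data.Fin as Fin using (Fin)
open import Data.Product using (Σ; ∃; _×_; _,_)
open import Relation.Nullary using (¬_)
open import Relation.Binary.PropositionalEquality using (_≡_)

record Field (c ℓ : Level) : Set (Level.suc (c ⊔ ℓ)) where
  field
    commRing : CommutativeRing c ℓ
  open CommutativeRing commRing public
  field
    0≉1      : ¬ (0# ≈ 1#)
    inverse  : ∀ x → ¬ (x ≈ 0#) → Σ Carrier λ y → x * y ≈ 1#

module _ {c ℓ : Level} (F : Field c ℓ) where
  open Field F

  HasCard : ℕ → Set (c ⊔ ℓ)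
  HasCard q = Σ (Fin q → Carrier) λ e →
                ((i j : Fin q) → e i ≈ e j → i ≡ j) × ((x : Carrier) → ∃ λ i → e i ≈ x)

  Vec : ℕ → Set c
  Vec n = Fin n → Carrier

  module _ {n : ℕ} where
    _≈ᵥ_ : Vec n → Vec n → Set ℓ
    u ≈ᵥ v = ∀ i → u i ≈ v i

    0ᵥ : Vec n
    0ᵥ i = 0#

    _+ᵥ_ : Vec n → Vec n → Vec n
    (u +ᵥ v) i = u i + v i

    _·ᵥ_ : Carrier → Vec n → Vec n
    (a ·ᵥ v) i = a * v i

    -ᵥ_ : Vec n → Vec n
    (-ᵥ v) i = - v i

  Σᵥ : ∀ {n} k → (Fin k → Vec n) → Vec n
  Σᵥ ℕ.zero    g = 0ᵥ
  Σᵥ (ℕ.suc k) g = g Fin.zero +ᵥ Σᵥ k (λ i → g (Fin.suc i))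

  lincomb : ∀ {n k} → (Fin k → Carrier) → (Fin k → Vec n) → Vec n
  lincomb {k = k} a b = Σᵥ k (λ i → a i ·ᵥ b i)

  record IsLinear {n : ℕ} (g : Vec n → Vec n) : Set (c ⊔ ℓ) where
    field
      cong  : ∀ {u v} → u ≈ᵥ v → g u ≈ᵥ g v
      additive : ∀ u v → g (u +ᵥ v) ≈ᵥ (g u +ᵥ g v)
      homogeneous : ∀ a v → g (a ·ᵥ v) ≈ᵥ (a ·ᵥ g v)

  record IsNondegAlternating {n : ℕ} (f : Vec n → Vec n → Carrier) : Set (c ⊔ ℓ) where
    field
      cong     : ∀ {u u′ v v′} → u ≈ᵥ u′ → v ≈ᵥ v′ → f u v ≈ f u′ v′
      +-left   : ∀ u u′ v → f (u +ᵥ u′) v ≈ f u v + f u′ v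
      ·-left   : ∀ a u v → f (a ·ᵥ u) v ≈ a * f u v
      +-right  : ∀ u v v′ → f u (v +ᵥ v′) ≈ f u v + f u v′
      ·-right  : ∀ a u v → f u (a ·ᵥ v) ≈ a * f u v
      alternating : ∀ v → f v v ≈ 0#
      nondegenerate : ∀ u → (∀ v → f u v ≈ 0#) → u ≈ᵥ 0ᵥ

  record IsSymplectic {n : ℕ} (f : Vec n → Vec n → Carrier) (σ : Vec n → Vec n) : Set (c ⊔ ℓ) where
    field
      linear   : IsLinear σ
      invertible : Σ (Vec n → Vec n) λ τ → (∀ v → σ (τ v) ≈ᵥ v) × (∀ v → τ (σ v) ≈ᵥ v)
      isometry : ∀ u v → f (σ u) (σ v) ≈ f u v

  record IsSubspace {n : ℕ} {p : Level} (U : Vec n → Set p) : Set (c ⊔ ℓ ⊔ p) where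
    field
      respects : ∀ {u v} → u ≈ᵥ v → U u → U v
      zero∈    : U 0ᵥ
      +-closed : ∀ {u v} → U u → U v → U (u +ᵥ v)
      ·-closed : ∀ a {v} → U v → U (a ·ᵥ v)

  HasDim : ∀ {n : ℕ} {p : Level} → (Vec n → Set p) → ℕ → Set (c ⊔ ℓ ⊔ p)
  HasDim {n} U k = Σ (Fin k → Vec n) λ b →
      (∀ i → U (b i))
    × (∀ a → lincomb a b ≈ᵥ 0ᵥ → ∀ i → a i ≈ 0#)
    × (∀ u → U u → ∃ λ a → u ≈ᵥ lincomb a b)

  SigmaInvariant : ∀ {n p} → (Vec n → Vec n) → (Vec n → Set p) → Set (c ⊔ p)
  SigmaInvariant σ U = ∀ u → U u → U (σ u)

  TotallyIsotropic : ∀ {n p} → (Vec n → Vec n → Carrier) → (Vec n → Set p) → Set (c ⊔ ℓ ⊔ p)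
  TotallyIsotropic f U = ∀ u v → U u → U v → f u v ≈ 0#

  TrivialIntersection : ∀ {n p} → (Vec n → Set p) → (Vec n → Set p) → Set (c ⊔ ℓ ⊔ p)
  TrivialIntersection U W = ∀ v → U v → W v → v ≈ᵥ 0ᵥ

  SameSubspace : ∀ {n p} → (Vec n → Set p) → (Vec n → Set p) → Set (c ⊔ p)
  SameSubspace U W = ∀ v → (U v → W v) × (W v → U v)

  Eigen : ∀ {n p} → (Vec n → Vec n) → Carrier → (Vec n → Set p) → Vec n → Set (ℓ ⊔ p)
  Eigen σ λ′ U u = U u × (σ u ≈ᵥ (λ′ ·ᵥ u))

OddPrimePower : ℕ → Set
OddPrimePower q = ∃ λ p → Prime p × ¬ (p ≡ 2) × ∃ λ k → ¬ (k ≡ 0) × q ≡ p ℕ.^ k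

{-# OPTIONS --safe #-}
-- As q is odd, 2 is invertible, and since σ² = -1 every σ-invariant subspace U splits as
-- U_ω ⊕ U_ω⁻¹ via the projections (1 + ω⁻¹σ)/2 and (1 + ωσ)/2.  Eigenvectors of the same
-- eigenvalue are f-orthogonal, because σ is an isometry and ω² = -1.  Now let X, Y be
-- σ-invariant, totally isotropic, of dimension m, with X ∩ Y = 0, so V = X ⊕ Y.  A vector of
-- Y_ω orthogonal to X_ω⁻¹ is also orthogonal to X_ω and to Y, hence to V, hence zero; so f
-- embeds Y_ω into the dual of X_ω⁻¹ and dim Y_ω ≤ dim X_ω⁻¹.  Together with the same argument
-- for ω⁻¹ this gives dim X_ω = dim Y_ω⁻¹ for each of the pairs (X,Y), (Y,Z), (Z,X); going round
-- the triangle makes all six dimensions equal, and dim X_ω + dim X_ω⁻¹ = m makes them m/2.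
--
-- Equality in F is decidable because F is finite; this makes Gaussian elimination, and with it
-- the exchange lemma and the extraction of bases, constructive.

module Submission where

open import Defs
open import Level using (Level; _⊔_)
open import Data.Nat as ℕ using (ℕ; zero; suc)
import Data.Nat.Properties as ℕ
open import Data.Nat.DivMod using (m∣n⇒o%n%m≡o%m; m*n%n≡0)
open import Data.Nat.Divisibility using (divides)
import Algebra.Properties.CommutativeMonoid.Sum
import Algebra.Solver.Ring.NaturalCoefficients.Default
open import Data.Fin as Fin using (Fin; zero; suc; toℕ; splitAt; punchIn)
open import Data.Fin.Properties using (any?; all?; join-splitAt; toℕ-injective)
open import Data.Fin.Permutation using (permutation)
open import Data.Product using (Σ; ∃; _×_; _,_; proj₁; proj₂)
open import Data.Sum.Properties using ([,]-∘)
open import Data.Vec.Functional using (_∷_; _++_; take; drop; tail; insertAt)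
open import Data.Vec.Functional.Properties using (lookup-++ˡ; lookup-++ʳ; insertAt-lookup; insertAt-punchIn)
open import Data.Vec.Functional.Relation.Unary.All.Properties using (++⁺)
open import Data.Empty using (⊥-elim)
open import Function using (_∘_)
open import Relation.Binary.PropositionalEquality as ≡ using (_≡_; _≢_; _≗_)
open import Relation.Binary.Definitions using (Decidable)
open import Relation.Nullary using (¬_; Dec; yes; no; ¬?)
open import Relation.Nullary.Decidable using (decidable-stable)

private
  module ℕΣ = Algebra.Properties.CommutativeMonoid.Sum ℕ.+-0-commutativeMonoid

[_<_] : ℕ → ℕ → ℕ
[ zero  < zero  ] = 0
[ zero  < suc _ ] = 1
[ suc _ < zero  ] = 0
[ suc m < suc n ] = [ m < n ]

[<]+[>]≡1 : ∀ m n → m ≢ n → [ m < n ] ℕ.+ [ n < m ] ≡ 1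
[<]+[>]≡1 zero    zero    m≢n = ⊥-elim (m≢n ≡.refl)
[<]+[>]≡1 zero    (suc n) _   = ≡.refl
[<]+[>]≡1 (suc m) zero    _   = ≡.refl
[<]+[>]≡1 (suc m) (suc n) m≢n = [<]+[>]≡1 m n (m≢n ∘ ≡.cong suc)

sum-ones : ∀ n → ℕΣ.sum {n} (λ _ → 1) ≡ n
sum-ones zero    = ≡.refl
sum-ones (suc n) = ≡.cong suc (sum-ones n)

-- Every orbit {i, π i} is counted once, at its smaller element.
fixedPointFree-involution⇒even : ∀ n (π : Fin n → Fin n) → (∀ i → π (π i) ≡ i) → (∀ i → π i ≢ i) →
                                 ∃ λ k → n ≡ k ℕ.+ k
fixedPointFree-involution⇒even n π ππ≡id π≢id = ℕΣ.sum below , (begin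
  n                                           ≡⟨ sum-ones n ⟨
  ℕΣ.sum {n} (λ _ → 1)                        ≡⟨ ℕΣ.sum-cong-≗ {n} orbit-counted-once ⟩
  ℕΣ.sum {n} (λ i → below i ℕ.+ below (π i))  ≡⟨ ℕΣ.∑-distrib-+ below (below ∘ π) ⟩
  ℕΣ.sum below ℕ.+ ℕΣ.sum (below ∘ π)         ≡⟨ ≡.cong (ℕΣ.sum below ℕ.+_) (ℕΣ.sum-permute below π-perm) ⟨
  ℕΣ.sum below ℕ.+ ℕΣ.sum below               ∎)
  where
    open ≡.≡-Reasoning
    π-perm = permutation π π ππ≡id ππ≡id
    below : Fin n → ℕ
    below i = [ toℕ i < toℕ (π i) ]
    orbit-counted-once : ∀ i → 1 ≡ below i ℕ.+ below (π i)
    orbit-counted-once i = ≡.sym (begin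
      below i ℕ.+ below (π i)
        ≡⟨ ≡.cong (λ j → below i ℕ.+ [ toℕ (π i) < toℕ j ]) (ππ≡id i) ⟩
      [ toℕ i < toℕ (π i) ] ℕ.+ [ toℕ (π i) < toℕ i ]
        ≡⟨ [<]+[>]≡1 _ _ (π≢id i ∘ ≡.sym ∘ toℕ-injective) ⟩
      1 ∎)

odd⇒¬double : ∀ {q} → q ℕ.% 2 ≡ 1 → ¬ ∃ λ k → q ≡ k ℕ.+ k
odd⇒¬double {q} q-odd (k , q≡k+k) = 0≢1 (≡.trans (≡.sym double-even) q-odd)
  where
    0≢1 : 0 ≢ 1
    0≢1 ()
    k+k≡k*2 : k ℕ.+ k ≡ k ℕ.* 2
    k+k≡k*2 = ≡.trans (≡.cong (k ℕ.+_) (≡.sym (ℕ.+-identityʳ k))) (ℕ.*-comm 2 k)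
    double-even : q ℕ.% 2 ≡ 0
    double-even = ≡.trans (≡.cong (ℕ._% 2) (≡.trans q≡k+k k+k≡k*2)) (m*n%n≡0 k 2)

%4≡1⇒odd : ∀ q → q ℕ.% 4 ≡ 1 → q ℕ.% 2 ≡ 1
%4≡1⇒odd q q≡1 = ≡.trans (≡.sym (m∣n⇒o%n%m≡o%m 2 4 q (divides 2 ≡.refl))) (≡.cong (ℕ._% 2) q≡1)

take++drop : ∀ {a} {A : Set a} m {n} (xs : Fin (m ℕ.+ n) → A) → take m xs ++ drop m xs ≗ xs
take++drop m {n} xs i = ≡.trans (≡.sym ([,]-∘ xs (splitAt m i))) (≡.cong xs (join-splitAt m n i))

module LinearAlgebra {c ℓ : Level} (F : Field c ℓ) where

  open Field F hiding (zero)
  open import Algebra.Properties.Ring ring public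
  open import Algebra.Properties.Semiring.Sum semiring public
  open import Relation.Binary.Reasoning.Setoid setoid

  -x*-y≈x*y : ∀ x y → - x * - y ≈ x * y
  -x*-y≈x*y x y = begin
    - x * - y        ≈⟨ -‿distribˡ-* x (- y) ⟨
    - (x * - y)      ≈⟨ -‿cong (-‿distribʳ-* x y) ⟨
    - (- (x * y))    ≈⟨ -‿involutive (x * y) ⟩
    x * y            ∎

  V : ℕ → Set c
  V = Vec F

  infix 4 _≋_
  _≋_ : ∀ {n} → V n → V n → Set ℓ
  _≋_ = _≈ᵥ_ F

  infixl 6 _⊕_
  _⊕_ : ∀ {n} → V n → V n → V n
  _⊕_ = _+ᵥ_ F

  infixr 7 _·_
  _·_ : ∀ {n} → Carrier → V n → V n
  _·_ = _·ᵥ_ F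

  𝟎 : ∀ {n} → V n
  𝟎 = 0ᵥ F

  infix 4 _∈Span_
  _∈Span_ : ∀ {n k} → V n → (Fin k → V n) → Set (c ⊔ ℓ)
  v ∈Span b = ∃ λ a → v ≋ lincomb F a b

  Independent : ∀ {n k} → (Fin k → V n) → Set (c ⊔ ℓ)
  Independent b = ∀ a → lincomb F a b ≋ 𝟎 → ∀ i → a i ≈ 0#

  Dependent : ∀ {n k} → (Fin k → V n) → Set (c ⊔ ℓ)
  Dependent b = ∃ λ x → (∃ λ i → ¬ x i ≈ 0#) × lincomb F x b ≋ 𝟎

  Σᵥ-pointwise : ∀ {n} k (g : Fin k → V n) j → Σᵥ F k g j ≡ sum (λ i → g i j)
  Σᵥ-pointwise zero    g j = ≡.refl
  Σᵥ-pointwise (suc k) g j = ≡.cong (g zero j +_) (Σᵥ-pointwise k (g ∘ suc) j)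

  Σᵥ-cong : ∀ {n} k {g g′ : Fin k → V n} → (∀ i → g i ≋ g′ i) → Σᵥ F k g ≋ Σᵥ F k g′
  Σᵥ-cong zero    eq j = refl
  Σᵥ-cong (suc k) eq j = +-cong (eq zero j) (Σᵥ-cong k (eq ∘ suc) j)

  Σᵥ-splitAt : ∀ {n} m k (g : Fin (m ℕ.+ k) → V n) → Σᵥ F (m ℕ.+ k) g ≋ Σᵥ F m (take m g) ⊕ Σᵥ F k (drop m g)
  Σᵥ-splitAt zero    k g j = sym (+-identityˡ _)
  Σᵥ-splitAt (suc m) k g j = trans (+-congˡ (Σᵥ-splitAt m k (g ∘ suc) j)) (sym (+-assoc _ _ _))

  lincomb-pointwise : ∀ {n k} (a : Fin k → Carrier) (b : Fin k → V n) j →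
                      lincomb F a b j ≈ sum (λ i → a i * b i j)
  lincomb-pointwise {k = k} a b j = reflexive (Σᵥ-pointwise k (λ i → a i · b i) j)

  lincomb-cong : ∀ {n k} {a a′ : Fin k → Carrier} {b b′ : Fin k → V n} →
                 (∀ i → a i ≈ a′ i) → (∀ i → b i ≋ b′ i) → lincomb F a b ≋ lincomb F a′ b′
  lincomb-cong {k = k} a≈a′ b≋b′ = Σᵥ-cong k (λ i j → *-cong (a≈a′ i) (b≋b′ i j))

  lincomb-zero : ∀ {n k} {a : Fin k → Carrier} (b : Fin k → V n) → (∀ i → a i ≈ 0#) → lincomb F a b ≋ 𝟎
  lincomb-zero {k = k} {a} b a≈0 j = begin
    lincomb F a b j           ≈⟨ lincomb-pointwise a b j ⟩
    sum (λ i → a i * b i j)   ≈⟨ sum-cong-≋ (λ i → trans (*-congʳ (a≈0 i)) (zeroˡ _)) ⟩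
    sum {k} (λ _ → 0#)        ≈⟨ sum-replicate-zero k ⟩
    0#                        ∎

  lincomb-coordinate≈0 : ∀ {n k} (x : Fin k → Carrier) {A : Fin k → V n} {j} → (∀ i → A i j ≈ 0#) →
                         lincomb F x A j ≈ 0#
  lincomb-coordinate≈0 {k = k} x {A} {j} Aj≈0 = begin
    lincomb F x A j           ≈⟨ lincomb-pointwise x A j ⟩
    sum (λ i → x i * A i j)   ≈⟨ sum-cong-≋ (λ i → trans (*-congˡ (Aj≈0 i)) (zeroʳ (x i))) ⟩
    sum {k} (λ _ → 0#)        ≈⟨ sum-replicate-zero k ⟩
    0#                        ∎

  lincomb-tail : ∀ {n k} (x : Fin k → Carrier) (A : Fin k → V (suc n)) j →
                 lincomb F x A (suc j) ≡ lincomb F x (tail ∘ A) j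
  lincomb-tail {k = k} x A j = ≡.trans (Σᵥ-pointwise k _ (suc j)) (≡.sym (Σᵥ-pointwise k _ j))

  lincomb-*ˡ : ∀ {n k} x (a : Fin k → Carrier) (b : Fin k → V n) → lincomb F (λ i → x * a i) b ≋ x · lincomb F a b
  lincomb-*ˡ x a b j = begin
    lincomb F (λ i → x * a i) b j     ≈⟨ lincomb-pointwise _ b j ⟩
    sum (λ i → x * a i * b i j)       ≈⟨ sum-cong-≋ (λ i → *-assoc x (a i) (b i j)) ⟩
    sum (λ i → x * (a i * b i j))     ≈⟨ *-distribˡ-sum x (λ i → a i * b i j) ⟨
    x * sum (λ i → a i * b i j)       ≈⟨ *-congˡ (lincomb-pointwise a b j) ⟨
    x * lincomb F a b j               ∎

  lincomb-++ : ∀ {n m k} (a : Fin (m ℕ.+ k) → Carrier) (b₁ : Fin m → V n) (b₂ : Fin k → V n) →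
               lincomb F a (b₁ ++ b₂) ≋ lincomb F (take m a) b₁ ⊕ lincomb F (drop m a) b₂
  lincomb-++ {m = m} {k} a b₁ b₂ j = trans (Σᵥ-splitAt m k _ j)
    (+-cong (Σᵥ-cong m (λ i j → *-congˡ (reflexive (≡.cong-app (lookup-++ˡ b₁ b₂ i) j))) j)
            (Σᵥ-cong k (λ i j → *-congˡ (reflexive (≡.cong-app (lookup-++ʳ b₁ b₂ i) j))) j))

  lincomb-insertAt : ∀ {n k} (x : Fin k → Carrier) i t (A : Fin (suc k) → V n) →
                     lincomb F (insertAt x i t) A ≋ t · A i ⊕ lincomb F x (A ∘ punchIn i)
  lincomb-insertAt x i t A j = begin
    lincomb F (insertAt x i t) A j                              ≈⟨ lincomb-pointwise (insertAt x i t) A j ⟩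
    sum (λ k → insertAt x i t k * A k j)                        ≈⟨ sum-remove {i = i} (λ k → insertAt x i t k * A k j) ⟩
    insertAt x i t i * A i j
      + sum (λ k → insertAt x i t (punchIn i k) * A (punchIn i k) j)
        ≈⟨ +-cong (*-congʳ (reflexive (insertAt-lookup x i t)))
                  (reflexive (sum-cong-≗ (λ k → ≡.cong (_* A (punchIn i k) j) (insertAt-punchIn x i t k)))) ⟩
    t * A i j + sum (λ k → x k * A (punchIn i k) j)             ≈⟨ +-congˡ (lincomb-pointwise x (A ∘ punchIn i) j) ⟨
    t * A i j + lincomb F x (A ∘ punchIn i) j                   ∎

  lincomb-⊕· : ∀ {n k} (x d : Fin k → Carrier) (u : Fin k → V n) w →
               lincomb F x (λ k → u k ⊕ d k · w) ≋ lincomb F x u ⊕ sum (λ k → x k * d k) · w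
  lincomb-⊕· x d u w j = begin
    lincomb F x (λ k → u k ⊕ d k · w) j
      ≈⟨ lincomb-pointwise x (λ k → u k ⊕ d k · w) j ⟩
    sum (λ k → x k * (u k j + d k * w j))
      ≈⟨ sum-cong-≋ (λ k → trans (distribˡ (x k) _ _) (+-congˡ (sym (*-assoc (x k) (d k) (w j))))) ⟩
    sum (λ k → x k * u k j + x k * d k * w j)
      ≈⟨ ∑-distrib-+ (λ k → x k * u k j) (λ k → x k * d k * w j) ⟩
    sum (λ k → x k * u k j) + sum (λ k → x k * d k * w j)
      ≈⟨ +-cong (sym (lincomb-pointwise x u j)) (sym (*-distribʳ-sum (w j) (λ k → x k * d k))) ⟩
    lincomb F x u j + sum (λ k → x k * d k) * w j ∎

  lincomb-lincomb : ∀ {n s k} (B : Fin s → Fin k → Carrier) (w : Fin s → V n) (b : Fin k → V n) →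
                    (∀ j → w j ≋ lincomb F (B j) b) →
                    ∀ a → lincomb F a w ≋ lincomb F (λ i → sum (λ j → a j * B j i)) b
  lincomb-lincomb B w b w≋Bb a t = begin
    lincomb F a w t
      ≈⟨ lincomb-pointwise a w t ⟩
    sum (λ j → a j * w j t)
      ≈⟨ sum-cong-≋ (λ j → *-congˡ (trans (w≋Bb j t) (lincomb-pointwise (B j) b t))) ⟩
    sum (λ j → a j * sum (λ i → B j i * b i t))
      ≈⟨ sum-cong-≋ (λ j → *-distribˡ-sum (a j) (λ i → B j i * b i t)) ⟩
    sum (λ j → sum (λ i → a j * (B j i * b i t)))
      ≈⟨ ∑-comm (λ j i → a j * (B j i * b i t)) ⟩
    sum (λ i → sum (λ j → a j * (B j i * b i t)))
      ≈⟨ sum-cong-≋ (λ i → trans (sum-cong-≋ (λ j → sym (*-assoc (a j) (B j i) (b i t))))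
                                 (sym (*-distribʳ-sum (b i t) (λ j → a j * B j i)))) ⟩
    sum (λ i → sum (λ j → a j * B j i) * b i t)
      ≈⟨ lincomb-pointwise _ b t ⟨
    lincomb F (λ i → sum (λ j → a j * B j i)) b t ∎

  ∈Span-resp : ∀ {n k} {b : Fin k → V n} {u v : V n} → v ≋ u → u ∈Span b → v ∈Span b
  ∈Span-resp v≋u (a , u≋ab) = a , λ t → trans (v≋u t) (u≋ab t)

  ∈Span-trans : ∀ {n s k} {w : Fin s → V n} {b : Fin k → V n} → (∀ j → w j ∈Span b) →
                ∀ {u} → u ∈Span w → u ∈Span b
  ∈Span-trans {w = w} {b} w∈b (a , u≋aw) =
    _ , λ t → trans (u≋aw t) (lincomb-lincomb (proj₁ ∘ w∈b) w b (proj₂ ∘ w∈b) a t)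

  ∈Span-here : ∀ {n k} (v : V n) (b : Fin k → V n) → v ∈Span (v ∷ b)
  ∈Span-here v b = (1# ∷ λ _ → 0#) , λ t →
    sym (trans (+-cong (*-identityˡ (v t)) (lincomb-zero b (λ _ → refl) t)) (+-identityʳ (v t)))

  ∈Span-there : ∀ {n k} (v : V n) {b : Fin k → V n} {u} → u ∈Span b → u ∈Span (v ∷ b)
  ∈Span-there v (a , u≋ab) = (0# ∷ a) , λ t →
    trans (u≋ab t) (sym (trans (+-congʳ (zeroˡ (v t))) (+-identityˡ _)))

  ∈Span-++ : ∀ {n m k} {b₁ : Fin m → V n} {b₂ : Fin k → V n} {u₁ u₂} →
             u₁ ∈Span b₁ → u₂ ∈Span b₂ → u₁ ⊕ u₂ ∈Span (b₁ ++ b₂)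
  ∈Span-++ {b₁ = b₁} {b₂} (a₁ , u₁≋) (a₂ , u₂≋) = a₁ ++ a₂ , λ t →
    sym (trans (lincomb-++ (a₁ ++ a₂) b₁ b₂ t)
               (+-cong (trans (lincomb-cong (reflexive ∘ lookup-++ˡ a₁ a₂) (λ _ _ → refl) t) (sym (u₁≋ t)))
                       (trans (lincomb-cong (reflexive ∘ lookup-++ʳ a₁ a₂) (λ _ _ → refl) t) (sym (u₂≋ t)))))

  standardBasis : ∀ {n} → Fin n → V n
  standardBasis zero    zero    = 1#
  standardBasis zero    (suc _) = 0#
  standardBasis (suc _) zero    = 0#
  standardBasis (suc i) (suc j) = standardBasis i j

  ∈Span-standardBasis : ∀ {n} (v : V n) → v ∈Span standardBasis
  ∈Span-standardBasis v = v , λ j → sym (lincomb-standardBasis v j)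
    where
      lincomb-standardBasis : ∀ {n} (v : V n) → lincomb F v standardBasis ≋ v
      lincomb-standardBasis {suc n} v zero = begin
        v zero * 1# + lincomb F (v ∘ suc) (standardBasis ∘ suc) zero
          ≈⟨ +-cong (*-identityʳ (v zero)) (lincomb-coordinate≈0 (v ∘ suc) (λ _ → refl)) ⟩
        v zero + 0#
          ≈⟨ +-identityʳ (v zero) ⟩
        v zero ∎
      lincomb-standardBasis {suc n} v (suc j) = begin
        v zero * 0# + lincomb F (v ∘ suc) (standardBasis ∘ suc) (suc j)
          ≈⟨ +-cong (zeroʳ (v zero)) (reflexive (lincomb-tail (v ∘ suc) (standardBasis ∘ suc) j)) ⟩
        0# + lincomb F (v ∘ suc) standardBasis j
          ≈⟨ +-identityˡ _ ⟩
        lincomb F (v ∘ suc) standardBasis j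
          ≈⟨ lincomb-standardBasis (v ∘ suc) j ⟩
        v (suc j) ∎

  lincomb∈ : ∀ {n k p} {U : V n → Set p} → IsSubspace F U → {b : Fin k → V n} → (∀ i → U (b i)) →
             ∀ a → U (lincomb F a b)
  lincomb∈ {k = zero}  U-sub b∈U a = IsSubspace.zero∈ U-sub
  lincomb∈ {k = suc k} U-sub b∈U a = IsSubspace.+-closed U-sub (IsSubspace.·-closed U-sub (a zero) (b∈U zero))
                                       (lincomb∈ U-sub (b∈U ∘ suc) (a ∘ suc))

  linear-𝟎 : ∀ {n} {g : V n → V n} → IsLinear F g → g 𝟎 ≋ 𝟎
  linear-𝟎 {g = g} g-lin t = begin
    g 𝟎 t        ≈⟨ IsLinear.cong g-lin (λ _ → sym (zeroˡ 0#)) t ⟩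
    g (0# · 𝟎) t ≈⟨ IsLinear.homogeneous g-lin 0# 𝟎 t ⟩
    0# * g 𝟎 t   ≈⟨ zeroˡ _ ⟩
    0#           ∎

  linear-lincomb : ∀ {n k} {g : V n → V n} → IsLinear F g → (a : Fin k → Carrier) (b : Fin k → V n) →
                   g (lincomb F a b) ≋ lincomb F a (g ∘ b)
  linear-lincomb {k = zero}  g-lin a b = linear-𝟎 g-lin
  linear-lincomb {k = suc k} g-lin a b t = trans (IsLinear.additive g-lin _ _ t)
    (+-cong (IsLinear.homogeneous g-lin (a zero) (b zero) t) (linear-lincomb g-lin (a ∘ suc) (b ∘ suc) t))

  module BilinearForm {n} {f : V n → V n → Carrier} (f-form : IsNondegAlternating F f) where
    open IsNondegAlternating f-form

    lincombˡ : ∀ {k} (a : Fin k → Carrier) (b : Fin k → V n) w → f (lincomb F a b) w ≈ sum (λ i → a i * f (b i) w)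
    lincombˡ {zero}  a b w = trans (cong (λ _ → sym (zeroˡ 0#)) (λ _ → refl)) (trans (·-left 0# 𝟎 w) (zeroˡ _))
    lincombˡ {suc k} a b w = trans (+-left _ _ w) (+-cong (·-left (a zero) (b zero) w) (lincombˡ (a ∘ suc) (b ∘ suc) w))

    lincombʳ : ∀ {k} (a : Fin k → Carrier) (b : Fin k → V n) w → f w (lincomb F a b) ≈ sum (λ i → a i * f w (b i))
    lincombʳ {zero}  a b w = trans (cong (λ _ → refl) (λ _ → sym (zeroˡ 0#))) (trans (·-right 0# w 𝟎) (zeroˡ _))
    lincombʳ {suc k} a b w = trans (+-right w _ _) (+-cong (·-right (a zero) w (b zero)) (lincombʳ (a ∘ suc) (b ∘ suc) w))

    ⊥-∈Span : ∀ {k} {w : Fin k → V n} {y x} → (∀ j → f y (w j) ≈ 0#) → x ∈Span w → f y x ≈ 0#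
    ⊥-∈Span {k} {w} {y} {x} y⊥w (a , x≋aw) = begin
      f y x                        ≈⟨ cong (λ _ → refl) x≋aw ⟩
      f y (lincomb F a w)          ≈⟨ lincombʳ a w y ⟩
      sum (λ j → a j * f y (w j))  ≈⟨ sum-cong-≋ (λ j → trans (*-congˡ (y⊥w j)) (zeroʳ (a j))) ⟩
      sum {k} (λ _ → 0#)           ≈⟨ sum-replicate-zero k ⟩
      0#                           ∎

  TrivialIntersection-sym : ∀ {n p} {U W : V n → Set p} → TrivialIntersection F U W → TrivialIntersection F W U
  TrivialIntersection-sym U∩W≡0 v v∈W v∈U = U∩W≡0 v v∈U v∈W

  independent-++ : ∀ {n m k p} {U W : V n → Set p} → IsSubspace F U → IsSubspace F W →
                   {b₁ : Fin m → V n} {b₂ : Fin k → V n} → (∀ i → U (b₁ i)) → (∀ j → W (b₂ j)) →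
                   Independent b₁ → Independent b₂ → TrivialIntersection F U W → Independent (b₁ ++ b₂)
  independent-++ {m = m} {U = U} {W} U-sub W-sub {b₁} {b₂} b₁∈U b₂∈W ind₁ ind₂ U∩W≡0 a a·b≋0 i =
    ≡.subst (_≈ 0#) (take++drop m a i) (++⁺ (_≈ 0#) (ind₁ a₁ u₁≋0) (ind₂ a₂ u₂≋0) i)
    where
      a₁ = take m a
      a₂ = drop m a
      u₁ = lincomb F a₁ b₁
      u₂ = lincomb F a₂ b₂
      u₁+u₂≋0 : u₁ ⊕ u₂ ≋ 𝟎
      u₁+u₂≋0 t = trans (sym (lincomb-++ a b₁ b₂ t)) (a·b≋0 t)
      -- u₁ = -u₂ lies in both U and W
      u₁∈W : W u₁
      u₁∈W = IsSubspace.respects W-sub (λ t → trans (-1*x≈-x (u₂ t)) (sym (+-inverseˡ-unique _ _ (u₁+u₂≋0 t))))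
               (IsSubspace.·-closed W-sub (- 1#) (lincomb∈ W-sub b₂∈W a₂))
      u₁≋0 : u₁ ≋ 𝟎
      u₁≋0 = U∩W≡0 u₁ (lincomb∈ U-sub b₁∈U a₁) u₁∈W
      u₂≋0 : u₂ ≋ 𝟎
      u₂≋0 t = trans (sym (+-identityˡ _)) (trans (+-congʳ (sym (u₁≋0 t))) (u₁+u₂≋0 t))

  dependent-tails : ∀ {n k} {A : Fin k → V (suc n)} → (∀ i → A i zero ≈ 0#) → Dependent (tail ∘ A) → Dependent A
  dependent-tails {A = A} A₀≈0 (x , x≉0 , x·tailA≋0) = x , x≉0 , λ where
    zero    → lincomb-coordinate≈0 x A₀≈0
    (suc j) → trans (reflexive (lincomb-tail x A j)) (x·tailA≋0 j)

  module Pivot {r s} (A : Fin (suc r) → V (suc s)) (i₀ : Fin (suc r)) (pivot : ¬ A i₀ zero ≈ 0#) where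

    p⁻¹ : Carrier
    p⁻¹ = proj₁ (inverse (A i₀ zero) pivot)

    factor : Fin r → Carrier
    factor k = - (A (punchIn i₀ k) zero * p⁻¹)

    cleared : Fin r → V (suc s)
    cleared k = A (punchIn i₀ k) ⊕ factor k · A i₀

    cleared-head≈0 : ∀ k → cleared k zero ≈ 0#
    cleared-head≈0 k = begin
      a + - (a * p⁻¹) * p      ≈⟨ +-congˡ (-‿distribˡ-* (a * p⁻¹) p) ⟨
      a + - (a * p⁻¹ * p)      ≈⟨ +-congˡ (-‿cong (trans (*-assoc a p⁻¹ p) (*-congˡ (trans (*-comm p⁻¹ p) p*p⁻¹≈1)))) ⟩
      a + - (a * 1#)           ≈⟨ +-congˡ (-‿cong (*-identityʳ a)) ⟩
      a + - a                  ≈⟨ -‿inverseʳ a ⟩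
      0#                       ∎
      where
        a = A (punchIn i₀ k) zero
        p = A i₀ zero
        p*p⁻¹≈1 = proj₂ (inverse p pivot)

    dependent : Dependent cleared → Dependent A
    dependent (x , (k , xₖ≉0) , x·cleared≋0) =
      insertAt x i₀ t ,
      (punchIn i₀ k , xₖ≉0 ∘ ≡.subst (_≈ 0#) (insertAt-punchIn x i₀ t k)) ,
      λ j → begin
        lincomb F (insertAt x i₀ t) A j                        ≈⟨ lincomb-insertAt x i₀ t A j ⟩
        t * A i₀ j + lincomb F x (A ∘ punchIn i₀) j            ≈⟨ +-comm _ _ ⟩
        lincomb F x (A ∘ punchIn i₀) j + t * A i₀ j            ≈⟨ lincomb-⊕· x factor (A ∘ punchIn i₀) (A i₀) j ⟨
        lincomb F x cleared j                                  ≈⟨ x·cleared≋0 j ⟩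
        0#                                                     ∎
      where t = sum (λ k → x k * factor k)

  module Elimination (_≟_ : Decidable _≈_) where

    length>dim⇒dependent : ∀ {s r} → s ℕ.< r → (A : Fin r → V s) → Dependent A
    length>dim⇒dependent {zero}  {suc r} _ A = (1# ∷ λ _ → 0#) , (zero , 0≉1 ∘ sym) , λ ()
    length>dim⇒dependent {suc s} {suc r} (ℕ.s≤s s<r) A with any? (λ i → ¬? (A i zero ≟ 0#))
    ... | yes (i₀ , pivot) = Pivot.dependent A i₀ pivot
                               (dependent-tails (Pivot.cleared-head≈0 A i₀ pivot) (length>dim⇒dependent s<r _))
    ... | no  no-pivot     = dependent-tails {A = A} (λ i → decidable-stable (A i zero ≟ 0#) (no-pivot ∘ (i ,_)))
                               (length>dim⇒dependent (ℕ.m<n⇒m<1+n s<r) (tail ∘ A))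

    independent-∈Span⇒≤ : ∀ {n r s} {u : Fin r → V n} {w : Fin s → V n} →
                          Independent u → (∀ i → u i ∈Span w) → r ℕ.≤ s
    independent-∈Span⇒≤ {r = r} {s} {u} {w} u-ind u∈w with r ℕ.≤? s
    ... | yes r≤s = r≤s
    ... | no  r≰s with length>dim⇒dependent (ℕ.≰⇒> r≰s) (proj₁ ∘ u∈w)
    ...   | x , (i , xᵢ≉0) , x·B≋0 = ⊥-elim (xᵢ≉0 (u-ind x x·u≋0 i))
      where
        x·u≋0 : lincomb F x u ≋ 𝟎
        x·u≋0 t = trans (lincomb-lincomb (proj₁ ∘ u∈w) u w (proj₂ ∘ u∈w) x t)
                        (lincomb-zero w (λ j → trans (sym (lincomb-pointwise x (proj₁ ∘ u∈w) j)) (x·B≋0 j)) t)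

    independent-∷ : ∀ {n k} {b : Fin k → V n} {v} → Independent b → ¬ v ∈Span b → Independent (v ∷ b)
    independent-∷ {b = b} {v} b-ind v∉b a a·vb≋0 with a zero ≟ 0#
    ... | yes a₀≈0 = λ { zero → a₀≈0 ; (suc i) → b-ind (a ∘ suc) rest≋0 i }
      where
        rest≋0 : lincomb F (a ∘ suc) b ≋ 𝟎
        rest≋0 t = trans (sym (+-identityˡ _))
                         (trans (+-congʳ (sym (trans (*-congʳ a₀≈0) (zeroˡ (v t))))) (a·vb≋0 t))
    ... | no  a₀≉0 = ⊥-elim (v∉b ((λ i → - a₀⁻¹ * a (suc i)) , λ t → sym (v≈ t)))
      where
        a₀⁻¹ = proj₁ (inverse (a zero) a₀≉0)
        v≈ : ∀ t → lincomb F (λ i → - a₀⁻¹ * a (suc i)) b t ≈ v t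
        v≈ t = begin
          lincomb F (λ i → - a₀⁻¹ * a (suc i)) b t     ≈⟨ lincomb-*ˡ (- a₀⁻¹) (a ∘ suc) b t ⟩
          - a₀⁻¹ * lincomb F (a ∘ suc) b t             ≈⟨ *-congˡ (+-inverseʳ-unique _ _ (a·vb≋0 t)) ⟩
          - a₀⁻¹ * - (a zero * v t)                    ≈⟨ -x*-y≈x*y a₀⁻¹ (a zero * v t) ⟩
          a₀⁻¹ * (a zero * v t)                        ≈⟨ *-assoc a₀⁻¹ (a zero) (v t) ⟨
          a₀⁻¹ * a zero * v t                          ≈⟨ *-congʳ (trans (*-comm a₀⁻¹ (a zero)) (proj₂ (inverse (a zero) a₀≉0))) ⟩
          1# * v t                                     ≈⟨ *-identityˡ (v t) ⟩
          v t                                          ∎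

module FiniteField {c ℓ : Level} (F : Field c ℓ) {q : ℕ} (card : HasCard F q) where

  open Field F hiding (zero)
  open LinearAlgebra F

  private
    enum : Fin q → Carrier
    enum = proj₁ card

    enum-injective : ∀ i j → enum i ≈ enum j → i ≡ j
    enum-injective = proj₁ (proj₂ card)

    enum-surjective : ∀ x → ∃ λ i → enum i ≈ x
    enum-surjective = proj₂ (proj₂ card)

  infix 4 _≟_
  _≟_ : Decidable _≈_
  x ≟ y with enum-surjective x | enum-surjective y
  ... | i , eᵢ≈x | j , eⱼ≈y with i Fin.≟ j
  ... | yes ≡.refl = yes (trans (sym eᵢ≈x) eⱼ≈y)
  ... | no  i≢j    = no λ x≈y → i≢j (enum-injective i j (trans eᵢ≈x (trans x≈y (sym eⱼ≈y))))

  open Elimination _≟_ public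

  -- If 1 + 1 ≈ 0 then x ↦ x + 1 is a fixed-point-free involution of F.
  odd⇒1+1≉0 : q ℕ.% 2 ≡ 1 → ¬ (1# + 1# ≈ 0#)
  odd⇒1+1≉0 q-odd 1+1≈0 = odd⇒¬double q-odd (fixedPointFree-involution⇒even q succ succ-involutive succ-fixedPointFree)
    where
      succ : Fin q → Fin q
      succ i = proj₁ (enum-surjective (enum i + 1#))

      enum-succ : ∀ i → enum (succ i) ≈ enum i + 1#
      enum-succ i = proj₂ (enum-surjective (enum i + 1#))

      succ-involutive : ∀ i → succ (succ i) ≡ i
      succ-involutive i = enum-injective _ _ (begin
        enum (succ (succ i))    ≈⟨ enum-succ (succ i) ⟩
        enum (succ i) + 1#      ≈⟨ +-congʳ (enum-succ i) ⟩
        enum i + 1# + 1#        ≈⟨ +-assoc _ _ _ ⟩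
        enum i + (1# + 1#)      ≈⟨ +-congˡ 1+1≈0 ⟩
        enum i + 0#             ≈⟨ +-identityʳ _ ⟩
        enum i                  ∎)
        where open import Relation.Binary.Reasoning.Setoid setoid

      succ-fixedPointFree : ∀ i → succ i ≢ i
      succ-fixedPointFree i succᵢ≡i = 0≉1 (sym (+-cancelˡ (enum i) 1# 0#
        (trans (sym (enum-succ i)) (trans (reflexive (≡.cong enum succᵢ≡i)) (sym (+-identityʳ _))))))

  ∃-vector? : ∀ k {p} (P : (Fin k → Carrier) → Set p) → (∀ a → Dec (P a)) →
              (∀ {a a′} → (∀ i → a i ≈ a′ i) → P a → P a′) → Dec (∃ P)
  ∃-vector? zero    P P? P-resp with P? (λ ())
  ... | yes Pa = yes (_ , Pa)
  ... | no ¬Pa = no λ (a , Pa) → ¬Pa (P-resp (λ ()) Pa)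
  ∃-vector? (suc k) P P? P-resp
    with any? (λ i → ∃-vector? k (P ∘ (enum i ∷_)) (P? ∘ (enum i ∷_))
                                  (λ a≈a′ → P-resp λ { zero → refl ; (suc j) → a≈a′ j }))
  ... | yes (_ , _ , Pa) = yes (_ , Pa)
  ... | no  ¬P           = no λ (a , Pa) → ¬P (proj₁ (enum-surjective (a zero)) , a ∘ suc ,
          P-resp (λ { zero → sym (proj₂ (enum-surjective (a zero))) ; (suc j) → refl }) Pa)

  infix 4 _∈Span?_
  _∈Span?_ : ∀ {n k} (v : V n) (b : Fin k → V n) → Dec (v ∈Span b)
  _∈Span?_ {k = k} v b = ∃-vector? k (λ a → v ≋ lincomb F a b) (λ a → all? (λ j → v j ≟ lincomb F a b j))
    (λ a≈a′ v≋ab j → trans (v≋ab j) (lincomb-cong a≈a′ (λ _ _ → refl) j))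

  independent-spanning-subfamily : ∀ {n p} (P : V n → Set p) s (w : Fin s → V n) → (∀ j → P (w j)) →
    ∃ λ k → Σ (Fin k → V n) λ b → (∀ i → P (b i)) × Independent b × (∀ j → w j ∈Span b)
  independent-spanning-subfamily P zero    w w∈P = 0 , (λ ()) , (λ ()) , (λ _ _ ()) , λ ()
  independent-spanning-subfamily P (suc s) w w∈P
    with independent-spanning-subfamily P s (w ∘ suc) (w∈P ∘ suc)
  ... | k , b , b∈P , b-ind , w∈b with w zero ∈Span? b
  ...   | yes w₀∈b = k , b , b∈P , b-ind , λ { zero → w₀∈b ; (suc j) → w∈b j }
  ...   | no  w₀∉b = suc k , w zero ∷ b , (λ { zero → w∈P zero ; (suc i) → b∈P i }) ,
                     independent-∷ b-ind w₀∉b ,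
                     λ { zero → ∈Span-here (w zero) b ; (suc j) → ∈Span-there (w zero) (w∈b j) }

  spanning⇒hasDim : ∀ {n s p} {U : V n → Set p} (w : Fin s → V n) → (∀ j → U (w j)) →
                    (∀ u → U u → u ∈Span w) → ∃ λ k → HasDim F U k
  spanning⇒hasDim {s = s} {U = U} w w∈U U⊆span with independent-spanning-subfamily U s w w∈U
  ... | k , b , b∈U , b-ind , w∈b = k , b , b∈U , b-ind , λ u u∈U → ∈Span-trans w∈b (U⊆span u u∈U)

  independent⇒spanning : ∀ {n k} {b : Fin k → V n} → n ℕ.≤ k → Independent b → ∀ v → v ∈Span b
  independent⇒spanning {n} {k} {b} n≤k b-ind v with v ∈Span? b
  ... | yes v∈b = v∈b
  ... | no  v∉b = ⊥-elim (ℕ.<⇒≱ k<n n≤k)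
    where
      k<n : k ℕ.< n
      k<n = independent-∈Span⇒≤ {u = v ∷ b} (independent-∷ b-ind v∉b) (∈Span-standardBasis ∘ (v ∷ b))

  direct-sum-spans : ∀ {n p k l} {U W : V n → Set p} → IsSubspace F U → IsSubspace F W →
                     TrivialIntersection F U W → HasDim F U k → HasDim F W l → n ℕ.≤ k ℕ.+ l →
                     ∀ v → ∃ λ u → ∃ λ w → U u × W w × v ≋ u ⊕ w
  direct-sum-spans {k = k} U-sub W-sub U∩W≡0 (b₁ , b₁∈U , b₁-ind , _) (b₂ , b₂∈W , b₂-ind , _) n≤k+l v
    with independent⇒spanning n≤k+l (independent-++ U-sub W-sub b₁∈U b₂∈W b₁-ind b₂-ind U∩W≡0) v
  ... | a , v≋ab = lincomb F (take k a) b₁ , lincomb F (drop k a) b₂ ,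
                   lincomb∈ U-sub b₁∈U (take k a) , lincomb∈ W-sub b₂∈W (drop k a) ,
                   λ t → trans (v≋ab t) (lincomb-++ a b₁ b₂ t)

  nondegenerate-pairing⇒≤ : ∀ {n p r s} {f : V n → V n → Carrier} → IsNondegAlternating F f →
                            {U : V n → Set p} → IsSubspace F U → {β : Fin r → V n} → (∀ i → U (β i)) →
                            Independent β → (w : Fin s → V n) → (∀ u → U u → (∀ j → f u (w j) ≈ 0#) → u ≋ 𝟎) →
                            r ℕ.≤ s
  nondegenerate-pairing⇒≤ {r = r} {s} {f} f-form U-sub {β} β∈U β-ind w U⊥w⇒0 =
    independent-∈Span⇒≤ {u = gram} gram-independent (∈Span-standardBasis ∘ gram)
    where
      gram : Fin r → V s
      gram i j = f (β i) (w j)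

      gram-independent : Independent gram
      gram-independent a a·gram≋0 = β-ind a (U⊥w⇒0 _ (lincomb∈ U-sub β∈U a) λ j →
        trans (BilinearForm.lincombˡ f-form a β (w j)) (trans (sym (lincomb-pointwise a gram j)) (a·gram≋0 j)))

module SymplecticEigenspaces {c ℓ : Level} (F : Field c ℓ) {q : ℕ} (card : HasCard F q)
  {n : ℕ} {f : Vec F n → Vec F n → Field.Carrier F} (f-form : IsNondegAlternating F f)
  {σ : Vec F n → Vec F n} (σ-symplectic : IsSymplectic F f σ) (σ²≈-1 : ∀ v → _≈ᵥ_ F (σ (σ v)) (-ᵥ_ F v))
  (1+1≉0 : ¬ Field._≈_ F (Field._+_ F (Field.1# F) (Field.1# F)) (Field.0# F)) where

  open Field F hiding (zero)
  open LinearAlgebra F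
  open FiniteField F card
  open BilinearForm f-form
  open import Algebra.Properties.CommutativeSemigroup *-commutativeSemigroup using (x∙yz≈y∙xz)
  open import Relation.Binary.Reasoning.Setoid setoid
  private
    module σ = IsLinear (IsSymplectic.linear σ-symplectic)
    module f = IsNondegAlternating f-form
    module ℛ = Algebra.Solver.Ring.NaturalCoefficients.Default commutativeSemiring

  ½ : Carrier
  ½ = proj₁ (inverse (1# + 1#) 1+1≉0)

  ½[x+x]≈x : ∀ x → ½ * (x + x) ≈ x
  ½[x+x]≈x x = begin
    ½ * (x + x)             ≈⟨ *-congˡ (+-cong (*-identityˡ x) (*-identityˡ x)) ⟨
    ½ * (1# * x + 1# * x)   ≈⟨ *-congˡ (distribʳ x 1# 1#) ⟨
    ½ * ((1# + 1#) * x)     ≈⟨ *-assoc ½ (1# + 1#) x ⟨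
    ½ * (1# + 1#) * x       ≈⟨ *-congʳ (trans (*-comm ½ _) (proj₂ (inverse (1# + 1#) 1+1≉0))) ⟩
    1# * x                  ≈⟨ *-identityˡ x ⟩
    x                       ∎

  x≈-x⇒x≈0 : ∀ {x} → x ≈ - x → x ≈ 0#
  x≈-x⇒x≈0 {x} x≈-x = begin
    x             ≈⟨ ½[x+x]≈x x ⟨
    ½ * (x + x)   ≈⟨ *-congˡ (trans (+-congˡ x≈-x) (-‿inverseʳ x)) ⟩
    ½ * 0#        ≈⟨ zeroʳ ½ ⟩
    0#            ∎

  eigenvectors-orthogonal : ∀ {ω u v} → ω * ω ≈ - 1# → σ u ≋ ω · u → σ v ≋ ω · v → f u v ≈ 0#
  eigenvectors-orthogonal {ω} {u} {v} ω²≈-1 σu≋ωu σv≋ωv = x≈-x⇒x≈0 (begin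
    f u v                 ≈⟨ IsSymplectic.isometry σ-symplectic u v ⟨
    f (σ u) (σ v)         ≈⟨ f.cong σu≋ωu σv≋ωv ⟩
    f (ω · u) (ω · v)     ≈⟨ f.·-left ω u (ω · v) ⟩
    ω * f u (ω · v)       ≈⟨ *-congˡ (f.·-right ω u v) ⟩
    ω * (ω * f u v)       ≈⟨ *-assoc ω ω (f u v) ⟨
    ω * ω * f u v         ≈⟨ *-congʳ ω²≈-1 ⟩
    - 1# * f u v          ≈⟨ -1*x≈-x (f u v) ⟩
    - f u v               ∎)

  Eigen-isSubspace : ∀ {p ω} {U : V n → Set p} → IsSubspace F U → IsSubspace F (Eigen F σ ω U)
  Eigen-isSubspace {ω = ω} U-sub = record
    { respects = λ u≋v (u∈U , σu≋ωu) → IsSubspace.respects U-sub u≋v u∈U ,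
        λ t → trans (sym (σ.cong u≋v t)) (trans (σu≋ωu t) (*-congˡ (u≋v t)))
    ; zero∈    = IsSubspace.zero∈ U-sub , λ t → trans (linear-𝟎 (IsSymplectic.linear σ-symplectic) t) (sym (zeroʳ ω))
    ; +-closed = λ {u} {v} (u∈U , σu≋ωu) (v∈U , σv≋ωv) → IsSubspace.+-closed U-sub u∈U v∈U ,
        λ t → trans (σ.additive u v t) (trans (+-cong (σu≋ωu t) (σv≋ωv t)) (sym (distribˡ ω _ _)))
    ; ·-closed = λ a {v} (v∈U , σv≋ωv) → IsSubspace.·-closed U-sub a v∈U ,
        λ t → trans (σ.homogeneous a v t) (trans (*-congˡ (σv≋ωv t)) (x∙yz≈y∙xz a ω (v t)))
    }

  module Eigenvalue (ω ω⁻¹ : Carrier) (ω²≈-1 : ω * ω ≈ - 1#) (ωω⁻¹≈1 : ω * ω⁻¹ ≈ 1#) where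

    ω⁻¹≈-ω : ω⁻¹ ≈ - ω
    ω⁻¹≈-ω = begin
      ω⁻¹                 ≈⟨ *-identityˡ ω⁻¹ ⟨
      1# * ω⁻¹            ≈⟨ *-congʳ (trans (-‿cong ω²≈-1) (-‿involutive 1#)) ⟨
      - (ω * ω) * ω⁻¹     ≈⟨ *-congʳ (-‿distribʳ-* ω ω) ⟩
      ω * - ω * ω⁻¹       ≈⟨ *-congʳ (*-comm ω (- ω)) ⟩
      - ω * ω * ω⁻¹       ≈⟨ *-assoc (- ω) ω ω⁻¹ ⟩
      - ω * (ω * ω⁻¹)     ≈⟨ *-congˡ ωω⁻¹≈1 ⟩
      - ω * 1#            ≈⟨ *-identityʳ (- ω) ⟩
      - ω                 ∎

    ω⁻¹²≈-1 : ω⁻¹ * ω⁻¹ ≈ - 1#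
    ω⁻¹²≈-1 = trans (*-cong ω⁻¹≈-ω ω⁻¹≈-ω) (trans (-x*-y≈x*y ω ω) ω²≈-1)

    ω⁻¹ω≈1 : ω⁻¹ * ω ≈ 1#
    ω⁻¹ω≈1 = trans (*-comm ω⁻¹ ω) ωω⁻¹≈1

    project : V n → V n
    project v = ½ · (v ⊕ ω⁻¹ · σ v)

    σ-project : ∀ v → σ (project v) ≋ ω · project v
    σ-project v t = begin
      σ (project v) t                     ≈⟨ σ.homogeneous ½ _ t ⟩
      ½ * σ (v ⊕ ω⁻¹ · σ v) t             ≈⟨ *-congˡ (σ.additive v _ t) ⟩
      ½ * (σ v t + σ (ω⁻¹ · σ v) t)       ≈⟨ *-congˡ (+-congˡ (σ.homogeneous ω⁻¹ (σ v) t)) ⟩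
      ½ * (σ v t + ω⁻¹ * σ (σ v) t)       ≈⟨ *-congˡ (+-congˡ (*-congˡ (σ²≈-1 v t))) ⟩
      ½ * (σ v t + ω⁻¹ * - v t)           ≈⟨ *-congˡ (+-congˡ ω⁻¹*-x≈ω*x) ⟩
      ½ * (σ v t + ω * v t)               ≈⟨ *-congˡ (+-congʳ (sym (trans (*-congʳ ωω⁻¹≈1) (*-identityˡ (σ v t))))) ⟩
      ½ * (ω * ω⁻¹ * σ v t + ω * v t)     ≈⟨ ℛ.solve 5 (λ h w w′ y x → h ℛ.:* (w ℛ.:* w′ ℛ.:* y ℛ.:+ w ℛ.:* x)
                                                          ℛ.:= w ℛ.:* (h ℛ.:* (x ℛ.:+ w′ ℛ.:* y)))
                                                refl ½ ω ω⁻¹ (σ v t) (v t) ⟩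
      ω * project v t                     ∎
      where
        ω⁻¹*-x≈ω*x : ω⁻¹ * - v t ≈ ω * v t
        ω⁻¹*-x≈ω*x = begin
          ω⁻¹ * - v t     ≈⟨ -‿distribʳ-* ω⁻¹ (v t) ⟨
          - (ω⁻¹ * v t)   ≈⟨ -‿distribˡ-* ω⁻¹ (v t) ⟩
          - ω⁻¹ * v t     ≈⟨ *-congʳ (trans (-‿cong ω⁻¹≈-ω) (-‿involutive ω)) ⟩
          ω * v t         ∎

    project∈Eigen : ∀ {p} {U : V n → Set p} → IsSubspace F U → SigmaInvariant F σ U → ∀ {v} → U v →
                    Eigen F σ ω U (project v)
    project∈Eigen U-sub U-inv {v} v∈U =
      IsSubspace.·-closed U-sub ½ (IsSubspace.+-closed U-sub v∈U (IsSubspace.·-closed U-sub ω⁻¹ (U-inv v v∈U))) ,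
      σ-project v

    project-fixes : ∀ {u} → σ u ≋ ω · u → project u ≋ u
    project-fixes {u} σu≋ωu t = begin
      ½ * (u t + ω⁻¹ * σ u t)      ≈⟨ *-congˡ (+-congˡ (*-congˡ (σu≋ωu t))) ⟩
      ½ * (u t + ω⁻¹ * (ω * u t))  ≈⟨ *-congˡ (+-congˡ (trans (sym (*-assoc ω⁻¹ ω (u t))) (*-congʳ ω⁻¹ω≈1))) ⟩
      ½ * (u t + 1# * u t)         ≈⟨ *-congˡ (+-congˡ (*-identityˡ (u t))) ⟩
      ½ * (u t + u t)              ≈⟨ ½[x+x]≈x (u t) ⟩
      u t                          ∎

    project-linear : IsLinear F project
    project-linear = record
      { cong        = λ u≋v t → *-congˡ (+-cong (u≋v t) (*-congˡ (σ.cong u≋v t)))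
      ; additive    = λ u v t → trans (*-congˡ (+-congˡ (*-congˡ (σ.additive u v t))))
          (ℛ.solve 6 (λ h x y w a b → h ℛ.:* ((x ℛ.:+ y) ℛ.:+ w ℛ.:* (a ℛ.:+ b))
                                       ℛ.:= h ℛ.:* (x ℛ.:+ w ℛ.:* a) ℛ.:+ h ℛ.:* (y ℛ.:+ w ℛ.:* b))
                     refl ½ (u t) (v t) ω⁻¹ (σ u t) (σ v t))
      ; homogeneous = λ a v t → trans (*-congˡ (+-congˡ (*-congˡ (σ.homogeneous a v t))))
          (ℛ.solve 5 (λ h a x w y → h ℛ.:* (a ℛ.:* x ℛ.:+ w ℛ.:* (a ℛ.:* y)) ℛ.:= a ℛ.:* (h ℛ.:* (x ℛ.:+ w ℛ.:* y)))
                     refl ½ a (v t) ω⁻¹ (σ v t))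
      }

    Eigen-hasDim : ∀ {p m} {U : V n → Set p} → IsSubspace F U → SigmaInvariant F σ U → HasDim F U m →
                   ∃ λ k → HasDim F (Eigen F σ ω U) k
    Eigen-hasDim U-sub U-inv (b , b∈U , _ , U⊆span) =
      spanning⇒hasDim (project ∘ b) (λ j → project∈Eigen U-sub U-inv (b∈U j)) λ u (u∈U , σu≋ωu) →
        let (a , u≋ab) = U⊆span u u∈U in
        a , λ t → trans (sym (project-fixes σu≋ωu t))
                        (trans (IsLinear.cong project-linear u≋ab t) (linear-lincomb project-linear a b t))

  module Splitting (ω ω⁻¹ : Carrier) (ω²≈-1 : ω * ω ≈ - 1#) (ωω⁻¹≈1 : ω * ω⁻¹ ≈ 1#) where

    module Ω   = Eigenvalue ω ω⁻¹ ω²≈-1 ωω⁻¹≈1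
    module Ω⁻¹ = Eigenvalue ω⁻¹ ω Ω.ω⁻¹²≈-1 Ω.ω⁻¹ω≈1

    project+project≋id : ∀ v → v ≋ Ω.project v ⊕ Ω⁻¹.project v
    project+project≋id v t = sym (begin
      ½ * (x + ω⁻¹ * y) + ½ * (x + ω * y)   ≈⟨ ℛ.solve 5 (λ h x w′ y w → h ℛ.:* (x ℛ.:+ w′ ℛ.:* y) ℛ.:+ h ℛ.:* (x ℛ.:+ w ℛ.:* y)
                                                              ℛ.:= h ℛ.:* ((x ℛ.:+ x) ℛ.:+ (w′ ℛ.:+ w) ℛ.:* y))
                                                    refl ½ x ω⁻¹ y ω ⟩
      ½ * ((x + x) + (ω⁻¹ + ω) * y)         ≈⟨ *-congˡ (+-congˡ (trans (*-congʳ ω⁻¹+ω≈0) (zeroˡ y))) ⟩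
      ½ * ((x + x) + 0#)                    ≈⟨ *-congˡ (+-identityʳ (x + x)) ⟩
      ½ * (x + x)                           ≈⟨ ½[x+x]≈x x ⟩
      x                                     ∎)
      where
        x = v t
        y = σ v t
        ω⁻¹+ω≈0 : ω⁻¹ + ω ≈ 0#
        ω⁻¹+ω≈0 = trans (+-congʳ Ω.ω⁻¹≈-ω) (-‿inverseˡ ω)

    Eigen-disjoint : ∀ {u} → σ u ≋ ω · u → σ u ≋ ω⁻¹ · u → u ≋ 𝟎
    Eigen-disjoint {u} σu≋ωu σu≋ω⁻¹u t = begin
      u t                  ≈⟨ *-identityˡ (u t) ⟨
      1# * u t             ≈⟨ *-congʳ Ω.ω⁻¹ω≈1 ⟨
      ω⁻¹ * ω * u t        ≈⟨ *-assoc ω⁻¹ ω (u t) ⟩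
      ω⁻¹ * (ω * u t)      ≈⟨ *-congˡ ωu≈0 ⟩
      ω⁻¹ * 0#             ≈⟨ zeroʳ ω⁻¹ ⟩
      0#                   ∎
      where
        ωu≈0 : ω * u t ≈ 0#
        ωu≈0 = x≈-x⇒x≈0 (begin
          ω * u t          ≈⟨ σu≋ωu t ⟨
          σ u t            ≈⟨ σu≋ω⁻¹u t ⟩
          ω⁻¹ * u t        ≈⟨ *-congʳ Ω.ω⁻¹≈-ω ⟩
          - ω * u t        ≈⟨ -‿distribˡ-* ω (u t) ⟨
          - (ω * u t)      ∎)

    dim-Eigen+dim-Eigen⁻¹≡dim : ∀ {p m a a′} {X : V n → Set p} → IsSubspace F X → SigmaInvariant F σ X →
      HasDim F X m → HasDim F (Eigen F σ ω X) a → HasDim F (Eigen F σ ω⁻¹ X) a′ → a ℕ.+ a′ ≡ m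
    dim-Eigen+dim-Eigen⁻¹≡dim X-sub X-inv (x , x∈X , x-ind , X⊆span)
                              (α , α∈Xω , α-ind , Xω⊆span) (α′ , α′∈Xω⁻¹ , α′-ind , Xω⁻¹⊆span) =
      ℕ.≤-antisym
        (independent-∈Span⇒≤
          (independent-++ (Eigen-isSubspace X-sub) (Eigen-isSubspace X-sub) α∈Xω α′∈Xω⁻¹ α-ind α′-ind
                          (λ u (_ , σu≋ωu) (_ , σu≋ω⁻¹u) → Eigen-disjoint σu≋ωu σu≋ω⁻¹u))
          (++⁺ (_∈Span x) (λ i → X⊆span _ (proj₁ (α∈Xω i))) (λ j → X⊆span _ (proj₁ (α′∈Xω⁻¹ j)))))
        (independent-∈Span⇒≤ x-ind λ i → ∈Span-resp (project+project≋id (x i))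
          (∈Span-++ (Xω⊆span _ (Ω.project∈Eigen X-sub X-inv (x∈X i)))
                    (Xω⁻¹⊆span _ (Ω⁻¹.project∈Eigen X-sub X-inv (x∈X i)))))

    Eigen-⊥-Eigen⁻¹⇒𝟎 : ∀ {p m} {X Y : V n → Set p} → IsSubspace F X → IsSubspace F Y → SigmaInvariant F σ X →
      TotallyIsotropic F f Y → TrivialIntersection F X Y → HasDim F X m → HasDim F Y m → n ℕ.≤ m ℕ.+ m →
      ∀ {y} → Eigen F σ ω Y y → (∀ x → Eigen F σ ω⁻¹ X x → f y x ≈ 0#) → y ≋ 𝟎
    Eigen-⊥-Eigen⁻¹⇒𝟎 X-sub Y-sub X-inv Y-iso X∩Y≡0 X-dim Y-dim n≤m+m {y} (y∈Y , σy≋ωy) y⊥Xω⁻¹ =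
      f.nondegenerate y λ v →
        let (u , w , u∈X , w∈Y , v≋u+w) = direct-sum-spans X-sub Y-sub X∩Y≡0 X-dim Y-dim n≤m+m v in
        begin
          f y v                                     ≈⟨ f.cong (λ _ → refl) v≋u+w ⟩
          f y (u ⊕ w)                               ≈⟨ f.+-right y u w ⟩
          f y u + f y w                             ≈⟨ +-congˡ (Y-iso y w y∈Y w∈Y) ⟩
          f y u + 0#                                ≈⟨ +-identityʳ (f y u) ⟩
          f y u                                     ≈⟨ f.cong (λ _ → refl) (project+project≋id u) ⟩
          f y (Ω.project u ⊕ Ω⁻¹.project u)         ≈⟨ f.+-right y _ _ ⟩
          f y (Ω.project u) + f y (Ω⁻¹.project u)   ≈⟨ +-cong (eigenvectors-orthogonal ω²≈-1 σy≋ωy (Ω.σ-project u))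
                                                               (y⊥Xω⁻¹ _ (Ω⁻¹.project∈Eigen X-sub X-inv u∈X)) ⟩
          0# + 0#                                   ≈⟨ +-identityʳ 0# ⟩
          0#                                        ∎

    dim-Eigen≤dim-Eigen⁻¹ : ∀ {p m b a′} {X Y : V n → Set p} → IsSubspace F X → IsSubspace F Y → SigmaInvariant F σ X →
      TotallyIsotropic F f Y → TrivialIntersection F X Y → HasDim F X m → HasDim F Y m → n ℕ.≤ m ℕ.+ m →
      HasDim F (Eigen F σ ω Y) b → HasDim F (Eigen F σ ω⁻¹ X) a′ → b ℕ.≤ a′
    dim-Eigen≤dim-Eigen⁻¹ X-sub Y-sub X-inv Y-iso X∩Y≡0 X-dim Y-dim n≤m+m
                          (β , β∈Yω , β-ind , _) (α′ , _ , _ , Xω⁻¹⊆span) =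
      nondegenerate-pairing⇒≤ f-form (Eigen-isSubspace Y-sub) β∈Yω β-ind α′ λ y y∈Yω y⊥α′ →
        Eigen-⊥-Eigen⁻¹⇒𝟎 X-sub Y-sub X-inv Y-iso X∩Y≡0 X-dim Y-dim n≤m+m y∈Yω λ x x∈Xω⁻¹ →
          ⊥-∈Span y⊥α′ (Xω⁻¹⊆span x x∈Xω⁻¹)

  record InvariantIsotropic {p} (m : ℕ) (X : V n → Set p) : Set (c ⊔ ℓ ⊔ p) where
    constructor invariantIsotropic
    field
      subspace  : IsSubspace F X
      invariant : SigmaInvariant F σ X
      isotropic : TotallyIsotropic F f X
      hasDim    : HasDim F X m

  module HalfDimensional (ω ω⁻¹ : Carrier) (ω²≈-1 : ω * ω ≈ - 1#) (ωω⁻¹≈1 : ω * ω⁻¹ ≈ 1#)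
                         {m : ℕ} (n≤m+m : n ℕ.≤ m ℕ.+ m) where

    private
      module ω   = Splitting ω ω⁻¹ ω²≈-1 ωω⁻¹≈1
      module ω⁻¹ = Splitting ω⁻¹ ω ω.Ω.ω⁻¹²≈-1 ω.Ω.ω⁻¹ω≈1

    dim-Eigen≡dim-Eigen⁻¹ : ∀ {p a b′} {X Y : V n → Set p} → InvariantIsotropic m X → InvariantIsotropic m Y →
      TrivialIntersection F X Y → HasDim F (Eigen F σ ω X) a → HasDim F (Eigen F σ ω⁻¹ Y) b′ → a ≡ b′
    dim-Eigen≡dim-Eigen⁻¹ (invariantIsotropic X-sub X-inv X-iso X-dim) (invariantIsotropic Y-sub Y-inv Y-iso Y-dim)
                          X∩Y≡0 Xω-dim Yω⁻¹-dim =
      ℕ.≤-antisym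
        (ω.dim-Eigen≤dim-Eigen⁻¹ Y-sub X-sub Y-inv X-iso (TrivialIntersection-sym X∩Y≡0) Y-dim X-dim n≤m+m Xω-dim Yω⁻¹-dim)
        (ω⁻¹.dim-Eigen≤dim-Eigen⁻¹ X-sub Y-sub X-inv Y-iso X∩Y≡0 X-dim Y-dim n≤m+m Yω⁻¹-dim Xω-dim)

open import Data.Nat using (_*_; _%_)

corollary3p3 : {c ℓ p : Level} (q : ℕ) → OddPrimePower q → q % 4 ≡ 1 →
  (F : Field c ℓ) → HasCard F q →
  (m : ℕ) (f : Vec F (2 * m) → Vec F (2 * m) → Field.Carrier F) → IsNondegAlternating F f →
  (ω ω⁻¹ : Field.Carrier F) →
  Field._≈_ F (Field._*_ F ω ω) (Field.-_ F (Field.1# F)) →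
  Field._≈_ F (Field._*_ F ω ω⁻¹) (Field.1# F) →
  (σ : Vec F (2 * m) → Vec F (2 * m)) → IsSymplectic F f σ →
  (∀ v → _≈ᵥ_ F (σ (σ v)) (-ᵥ_ F v)) →
  (X Y Z : Vec F (2 * m) → Set p) →
  IsSubspace F X → IsSubspace F Y → IsSubspace F Z →
  SigmaInvariant F σ X → SigmaInvariant F σ Y → SigmaInvariant F σ Z →
  TotallyIsotropic F f X → TotallyIsotropic F f Y → TotallyIsotropic F f Z →
  HasDim F X m → HasDim F Y m → HasDim F Z m →
  ¬ SameSubspace F X Y → ¬ SameSubspace F Y Z → ¬ SameSubspace F Z X →
  TrivialIntersection F X Y → TrivialIntersection F Y Z → TrivialIntersection F Z X →
  ∃ λ k → m ≡ 2 * k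
    × HasDim F (Eigen F σ ω X) k × HasDim F (Eigen F σ ω⁻¹ X) k
    × HasDim F (Eigen F σ ω Y) k × HasDim F (Eigen F σ ω⁻¹ Y) k
    × HasDim F (Eigen F σ ω Z) k × HasDim F (Eigen F σ ω⁻¹ Z) k
corollary3p3 q _ q%4≡1 F card m f f-form ω ω⁻¹ ω²≈-1 ωω⁻¹≈1 σ σ-symplectic σ²≈-1 X Y Z
             X-sub Y-sub Z-sub X-inv Y-inv Z-inv X-iso Y-iso Z-iso X-dim Y-dim Z-dim _ _ _ X∩Y≡0 Y∩Z≡0 Z∩X≡0 =
  k , m≡2k , proj₂ Xω , ≡.subst (HasDim F _) Xω⁻¹≡k (proj₂ Xω⁻¹) ,
  ≡.subst (HasDim F _) Yω≡k (proj₂ Yω) , ≡.subst (HasDim F _) Yω⁻¹≡k (proj₂ Yω⁻¹) ,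
  ≡.subst (HasDim F _) Zω≡k (proj₂ Zω) , ≡.subst (HasDim F _) Zω⁻¹≡k (proj₂ Zω⁻¹)
  where
    open SymplecticEigenspaces F card f-form σ-symplectic σ²≈-1 (FiniteField.odd⇒1+1≉0 F card (%4≡1⇒odd q q%4≡1))
    open Splitting ω ω⁻¹ ω²≈-1 ωω⁻¹≈1 using (module Ω; module Ω⁻¹; dim-Eigen+dim-Eigen⁻¹≡dim)
    open HalfDimensional ω ω⁻¹ ω²≈-1 ωω⁻¹≈1 {m} (ℕ.≤-reflexive (≡.cong (m ℕ.+_) (ℕ.+-identityʳ m)))
    open LinearAlgebra F using (TrivialIntersection-sym)
    X′ = invariantIsotropic X-sub X-inv X-iso X-dim
    Y′ = invariantIsotropic Y-sub Y-inv Y-iso Y-dim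
    Z′ = invariantIsotropic Z-sub Z-inv Z-iso Z-dim
    Xω   = Ω.Eigen-hasDim X-sub X-inv X-dim
    Xω⁻¹ = Ω⁻¹.Eigen-hasDim X-sub X-inv X-dim
    Yω   = Ω.Eigen-hasDim Y-sub Y-inv Y-dim
    Yω⁻¹ = Ω⁻¹.Eigen-hasDim Y-sub Y-inv Y-dim
    Zω   = Ω.Eigen-hasDim Z-sub Z-inv Z-dim
    Zω⁻¹ = Ω⁻¹.Eigen-hasDim Z-sub Z-inv Z-dim
    k = proj₁ Xω
    Yω⁻¹≡k = ≡.sym (dim-Eigen≡dim-Eigen⁻¹ X′ Y′ X∩Y≡0 (proj₂ Xω) (proj₂ Yω⁻¹))
    Zω≡k   = ≡.trans (dim-Eigen≡dim-Eigen⁻¹ Z′ Y′ (TrivialIntersection-sym Y∩Z≡0) (proj₂ Zω) (proj₂ Yω⁻¹)) Yω⁻¹≡k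
    Xω⁻¹≡k = ≡.trans (≡.sym (dim-Eigen≡dim-Eigen⁻¹ Z′ X′ Z∩X≡0 (proj₂ Zω) (proj₂ Xω⁻¹))) Zω≡k
    Yω≡k   = ≡.trans (dim-Eigen≡dim-Eigen⁻¹ Y′ X′ (TrivialIntersection-sym X∩Y≡0) (proj₂ Yω) (proj₂ Xω⁻¹)) Xω⁻¹≡k
    Zω⁻¹≡k = ≡.sym (dim-Eigen≡dim-Eigen⁻¹ X′ Z′ (TrivialIntersection-sym Z∩X≡0) (proj₂ Xω) (proj₂ Zω⁻¹))
    m≡2k : m ≡ 2 * k
    m≡2k = ≡.trans (≡.sym (dim-Eigen+dim-Eigen⁻¹≡dim X-sub X-inv X-dim (proj₂ Xω) (proj₂ Xω⁻¹)))
                   (≡.cong (k ℕ.+_) (≡.trans Xω⁻¹≡k (≡.sym (ℕ.+-identityʳ k))))
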